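{- For $n\ge 1$ let $a_n = |S_n^2(132,231,312)|$. Then $a_1=1$ and $a_{n+1} = a_n + 3$ for all $n\ge 1$.
   Context: A $3$-permutation of size $n$ is an ordered pair $(\sigma,\sigma')$ of permutations of $[n]=\{1,\dots,n\}$. A (classical) permutation $\tau\in S_n$ contains a pattern $\pi\in S_k$ if there are indices $c_1<\dots<c_k$ such that $\tau(c_1)\cdots\tau(c_k)$ is order-isomorphic to $\pi$, and avoids $\pi$ otherwise. A $3$-permutation $(\sigma,\sigma')$ avoids a pattern $\pi\in S_k$ if each of the three permutations $\sigma$, $\sigma'$, and $\sigma'\circ\sigma^{ -1}$ (where $(\sigma'\circ\sigma^{ -1})(i)=\sigma'(\sigma^{ -1}(i))$) avoids $\pi$. $S_n^2(\pi_1,\dots,\pi_m)$ denotes the set of $3$-permutations of size $n$ avoiding each of $\pi_1,\dots,\pi_m$. Patterns are written in one-line notation. -}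

module Defs where

open import Data.Nat using (ℕ; zero; suc)
open import Data.Bool using (Bool; true; false; _∧_; _∨_; not; if_then_else_)
open import Data.Fin using (Fin; toℕ; _≟_)
import Data.Nat as ℕ
import Data.Fin as Fin
open import Data.Vec using (Vec; []; _∷_; lookup; tabulate)
open import Data.List using (List; []; _∷_; concatMap; map; allFin; filterᵇ; length; foldr)
open import Data.Product using (_×_; _,_)
open import Relation.Nullary.Decidable using (⌊_⌋)

all : ∀ {A : Set} → (A → Bool) → List A → Bool
all p = foldr (λ x r → p x ∧ r) true

any : ∀ {A : Set} → (A → Bool) → List A → Bool
any p = foldr (λ x r → p x ∨ r) false

_<ᵇ_ : ∀ {n} → Fin n → Fin n → Bool
i <ᵇ j = toℕ i ℕ.<ᵇ toℕ j

-- A function [n] → [n] in one-line notation: τ(i) = lookup τ i  (Fin n ≅ [n]).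
Word : ℕ → Set
Word n = Vec (Fin n) n

allVecs : (n k : ℕ) → List (Vec (Fin n) k)
allVecs n zero    = [] ∷ []
allVecs n (suc k) = concatMap (λ x → map (x ∷_) (allVecs n k)) (allFin n)

-- τ is a permutation of [n] iff it is injective (on a finite set of size n).
isPerm : ∀ {n} → Word n → Bool
isPerm {n} τ = all (λ i → all (λ j → ⌊ i ≟ j ⌋ ∨ not ⌊ lookup τ i ≟ lookup τ j ⌋) (allFin n)) (allFin n)

Perms : (n : ℕ) → List (Word n)
Perms n = filterᵇ isPerm (allVecs n n)

_∘ₚ_ : ∀ {n} → Word n → Word n → Word n
σ' ∘ₚ σ = tabulate (λ i → lookup σ' (lookup σ i))

-- Inverse of a permutation: σ⁻¹(j) is the (unique) i with σ(i) = j.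
-- findPre v j = index of the first occurrence of j in v (default: last index).
findPre : ∀ {n m} → Vec (Fin n) (suc m) → Fin n → Fin (suc m)
findPre {m = zero}  (x ∷ [])       j = Fin.zero
findPre {m = suc m} (x ∷ xs@(_ ∷ _)) j = if ⌊ x ≟ j ⌋ then Fin.zero else Fin.suc (findPre xs j)

inv : ∀ {n} → Word n → Word n
inv {zero}  σ = []
inv {suc n} σ = tabulate (λ j → findPre σ j)

strictlyIncreasing : ∀ {n k} → Vec (Fin n) k → Bool
strictlyIncreasing {k = k} c =
  all (λ a → all (λ b → not (a <ᵇ b) ∨ (lookup c a <ᵇ lookup c b)) (allFin k)) (allFin k)

contains : ∀ {n k} → Word n → Word k → Bool
contains {n} {k} τ π = any (λ c → strictlyIncreasing c ∧
    all (λ a → all (λ b → ⌊ Data.Bool._≟_ (lookup τ (lookup c a) <ᵇ lookup τ (lookup c b))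
                                           (lookup π a <ᵇ lookup π b) ⌋) (allFin k)) (allFin k))
  (allVecs n k)
  where import Data.Bool

avoids : ∀ {n k} → Word n → Word k → Bool
avoids τ π = not (contains τ π)

-- A 3-permutation (σ, σ') avoids π iff σ, σ' and σ' ∘ σ⁻¹ all avoid π.
avoids₃ : ∀ {n k} → Word n × Word n → Word k → Bool
avoids₃ (σ , σ') π = avoids σ π ∧ avoids σ' π ∧ avoids (σ' ∘ₚ inv σ) π

avoidsAll₃ : ∀ {n k} → List (Word k) → Word n × Word n → Bool
avoidsAll₃ πs s = all (avoids₃ s) πs

S² : (n : ℕ) → ∀ {k} → List (Word k) → List (Word n × Word n)
S² n πs = filterᵇ (avoidsAll₃ πs) (concatMap (λ σ → map (σ ,_) (Perms n)) (Perms n))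

f0 f1 f2 : Fin 3
f0 = Fin.zero
f1 = Fin.suc Fin.zero
f2 = Fin.suc (Fin.suc Fin.zero)

p132 p231 p312 : Word 3
p132 = f0 ∷ f2 ∷ f1 ∷ []
p231 = f1 ∷ f2 ∷ f0 ∷ []
p312 = f2 ∷ f0 ∷ f1 ∷ []

a : ℕ → ℕ
a n = length (S² n (p132 ∷ p231 ∷ p312 ∷ []))

{-# OPTIONS --safe #-}
-- A permutation avoids 132, 231 and 312 iff every triple of its entries has shape
-- 123, 213 or 321.  Scanning such a permutation τ of {0, …, n−1} from the left with
-- m = τ(0), each new entry either continues the descent m, m−1, …, 0 or, once 0 has
-- appeared, is the least unused value (anything else, together with τ(0) and the later
-- position of the expected value, forms a forbidden triple).  Hence τ = rev m, the
-- word m, m−1, …, 0, m+1, …, n−1, and there are exactly n such permutations.  Each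
-- rev m is an involution, so for (σ, σ′) = (rev c, rev d) the third permutation
-- σ′ ∘ σ⁻¹ = rev d ∘ rev c avoids the patterns exactly when c = 0, d = 0 or c = d,
-- leaving n + 2(n − 1) pairs.
module Submission where

open import Data.Bool using (Bool; true; false; T; not; if_then_else_)
import Data.Bool as Bool
open import Data.Bool.Properties using (T-≡; T-∧; T-∨; ⇔→≡)
open import Data.Empty using (⊥-elim)
open import Data.Fin as Fin using (Fin; toℕ; fromℕ<)
import Data.Fin.Properties as Fin
open import Data.List using (List; []; _∷_; map; concatMap; cartesianProductWith; cartesianProduct; allFin; filterᵇ; length; _++_)
open import Data.List.Properties using (length-map; length-++; length-tabulate)
open import Data.List.Membership.Propositional using (_∈_)
open import Data.List.Membership.Propositional.Properties
open import Data.List.Membership.Propositional.Properties.WithK using (unique∧set⇒bag)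
open import Data.List.Relation.Binary.BagAndSetEquality using (∼bag⇒↭)
open import Data.List.Relation.Binary.Permutation.Propositional.Properties using (↭-length)
open import Data.List.Relation.Unary.All as All using (All; []; _∷_)
open import Data.List.Relation.Unary.AllPairs using ([]; _∷_)
open import Data.List.Relation.Unary.Any using (here; there)
open import Data.List.Relation.Unary.Unique.Propositional using (Unique)
import Data.List.Relation.Unary.Unique.Propositional.Properties as Unique
open import Data.Nat using (ℕ; zero; suc; _+_; _∸_; _≤_; _<_; _≥_; z≤n; s≤s; z<s; s<s; _≤?_)
import Data.Nat as ℕ
open import Data.Nat.Induction using (<-rec)
open import Data.Nat.Properties
open import Data.Nat.Tactic.RingSolver using (solve-∀)
open import Data.Product using (_×_; _,_; proj₁; proj₂; ∃-syntax)
open import Data.Sum using (_⊎_; inj₁; inj₂)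
open import Data.Vec using (Vec; []; _∷_; lookup; tabulate)
open import Data.Vec.Properties using (∷-injective; lookup∘tabulate; tabulate∘lookup; tabulate-cong)
open import Function using (_∘_)
open import Function.Bundles using (_⇔_; mk⇔; Equivalence)
open import Function.Definitions using (Injective)
import Function.Properties.Equivalence as ⇔
open import Relation.Binary.Definitions using (tri<; tri≈; tri>)
open import Relation.Binary.PropositionalEquality
open import Relation.Nullary using (¬_; yes; no)
open import Relation.Nullary.Decidable using (⌊_⌋; toWitness; fromWitness)

open import Defs

open Equivalence using (to; from)

module _ {A : Set} {p : A → Bool} where

  T-all : ∀ {xs} → T (all p xs) ⇔ All (T ∘ p) xs
  T-all = mk⇔ elim intro
    where
    elim : ∀ {xs} → T (all p xs) → All (T ∘ p) xs
    elim {[]}    _ = []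
    elim {_ ∷ _} t = let px , rest = to T-∧ t in px ∷ elim rest
    intro : ∀ {xs} → All (T ∘ p) xs → T (all p xs)
    intro []         = _
    intro (px ∷ pxs) = from T-∧ (px , intro pxs)

  T-any⁻ : ∀ {xs} → T (any p xs) → ∃[ x ] x ∈ xs × T (p x)
  T-any⁻ {y ∷ _} t with to T-∨ t
  ... | inj₁ py = y , here refl , py
  ... | inj₂ t′ = let x , x∈ , px = T-any⁻ t′ in x , there x∈ , px

  T-any⁺ : ∀ {xs x} → x ∈ xs → T (p x) → T (any p xs)
  T-any⁺ (here refl) px = from T-∨ (inj₁ px)
  T-any⁺ (there x∈)  px = from T-∨ (inj₂ (T-any⁺ x∈ px))

T-allFin : ∀ {n} {p : Fin n → Bool} → T (all p (allFin n)) ⇔ (∀ i → T (p i))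
T-allFin {n} = mk⇔ (λ t i → All.lookup (to (T-all {xs = allFin n}) t) (∈-allFin i))
                   (λ h → from (T-all {xs = allFin n}) (All.tabulate λ {i} _ → h i))

T-not : ∀ {b} → T (not b) ⇔ (¬ T b)
T-not {true}  = mk⇔ (λ ()) (λ ¬t → ¬t _)
T-not {false} = mk⇔ (λ _ ()) _

T-injective : ∀ {b c} → (T b ⇔ T c) → b ≡ c
T-injective e = ⇔→≡ (⇔.trans (⇔.sym T-≡) (⇔.trans e T-≡))

concatMap-map≡cartesianProductWith : ∀ {A B C : Set} (f : A → B → C) xs ys →
  concatMap (λ x → map (f x) ys) xs ≡ cartesianProductWith f xs ys
concatMap-map≡cartesianProductWith f []       ys = refl
concatMap-map≡cartesianProductWith f (x ∷ xs) ys =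
  cong (map (f x) ys ++_) (concatMap-map≡cartesianProductWith f xs ys)

∈-allVecs : ∀ {n k} (v : Vec (Fin n) k) → v ∈ allVecs n k
∈-allVecs []      = here refl
∈-allVecs {n} {suc k} (x ∷ v) =
  subst (x ∷ v ∈_) (sym (concatMap-map≡cartesianProductWith _∷_ (allFin n) (allVecs n k)))
    (∈-cartesianProductWith⁺ _∷_ (∈-allFin x) (∈-allVecs v))

allVecs-unique : ∀ n k → Unique (allVecs n k)
allVecs-unique n zero    = [] ∷ []
allVecs-unique n (suc k) =
  subst Unique (sym (concatMap-map≡cartesianProductWith _∷_ (allFin n) (allVecs n k)))
    (Unique.cartesianProductWith⁺ _∷_ ∷-injective (Unique.allFin⁺ n) (allVecs-unique n k))

length-filterᵇ-unique : ∀ {A : Set} {p : A → Bool} {xs ys} → Unique xs → Unique ys →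
  (∀ {x} → x ∈ ys ⇔ (x ∈ xs × T (p x))) → length (filterᵇ p xs) ≡ length ys
length-filterᵇ-unique {p = p} xs-unique ys-unique same =
  ↭-length (∼bag⇒↭ (unique∧set⇒bag (Unique.filter⁺ _ xs-unique) ys-unique (mk⇔
    (from same ∘ ∈-filter⁻ (Bool.T? ∘ p))
    (λ x∈ys → let x∈xs , px = to same x∈ys in ∈-filter⁺ (Bool.T? ∘ p) x∈xs px))))

-- Entries as natural numbers, with the junk value 0 past the end of the vector.
_!_ : ∀ {n k} → Vec (Fin n) k → ℕ → ℕ
[]      ! _     = 0
(x ∷ _) ! zero  = toℕ x
(_ ∷ v) ! suc i = v ! i

!-lookup : ∀ {n k} (v : Vec (Fin n) k) i → v ! toℕ i ≡ toℕ (lookup v i)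
!-lookup (_ ∷ _) Fin.zero    = refl
!-lookup (_ ∷ v) (Fin.suc i) = !-lookup v i

!-fromℕ< : ∀ {n k i} (v : Vec (Fin n) k) (i<k : i < k) → v ! i ≡ toℕ (lookup v (fromℕ< i<k))
!-fromℕ< v i<k = trans (cong (v !_) (sym (Fin.toℕ-fromℕ< i<k))) (!-lookup v (fromℕ< i<k))

!-< : ∀ {n k i} (v : Vec (Fin n) k) → i < k → v ! i < n
!-< v i<k = subst (_< _) (sym (!-fromℕ< v i<k)) (Fin.toℕ<n _)

!-ext : ∀ {n k} (v w : Vec (Fin n) k) → (∀ {i} → i < k → v ! i ≡ w ! i) → v ≡ w
!-ext []      []      _ = refl
!-ext (x ∷ v) (y ∷ w) h = cong₂ _∷_ (Fin.toℕ-injective (h (s≤s z≤n))) (!-ext v w (h ∘ s≤s))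

!-injective : ∀ {n k} {v : Vec (Fin n) k} → Injective _≡_ _≡_ (lookup v) →
  ∀ {i j} → i < k → j < k → v ! i ≡ v ! j → i ≡ j
!-injective {v = v} injective {i} {j} i<k j<k vi≡vj = begin
  i                   ≡⟨ Fin.toℕ-fromℕ< i<k ⟨
  toℕ (fromℕ< i<k)    ≡⟨ cong toℕ (injective (Fin.toℕ-injective lookups≡)) ⟩
  toℕ (fromℕ< j<k)    ≡⟨ Fin.toℕ-fromℕ< j<k ⟩
  j                   ∎
  where
  open ≡-Reasoning
  lookups≡ : toℕ (lookup v (fromℕ< i<k)) ≡ toℕ (lookup v (fromℕ< j<k))
  lookups≡ = trans (sym (!-fromℕ< v i<k)) (trans vi≡vj (!-fromℕ< v j<k))

!-surjective : ∀ {n k} {v : Vec (Fin n) k} → (∀ y → ∃[ x ] lookup v x ≡ y) →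
  ∀ {w} → w < n → ∃[ r ] r < k × v ! r ≡ w
!-surjective {v = v} surjective w<n =
  let r , vr≡w = surjective (fromℕ< w<n)
  in toℕ r , Fin.toℕ<n r , trans (!-lookup v r) (trans (cong toℕ vr≡w) (Fin.toℕ-fromℕ< w<n))

-- Patterns of length three

pattern f₀ = Fin.zero
pattern f₁ = Fin.suc Fin.zero
pattern f₂ = Fin.suc (Fin.suc Fin.zero)

module _ {A : Set} (_≺_ : A → A → Set) (≺-trans : ∀ {x y z} → x ≺ y → y ≺ z → x ≺ z) where

  lookup-increasing₃ : ∀ {x y z} → x ≺ y → y ≺ z →
    ∀ {p q} → p Fin.< q → lookup (x ∷ y ∷ z ∷ []) p ≺ lookup (x ∷ y ∷ z ∷ []) q
  lookup-increasing₃ x≺y y≺z {f₀} {f₁} _ = x≺y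
  lookup-increasing₃ x≺y y≺z {f₀} {f₂} _ = ≺-trans x≺y y≺z
  lookup-increasing₃ x≺y y≺z {f₁} {f₂} _ = y≺z
  lookup-increasing₃ _ _ {_}  {f₀} ()
  lookup-increasing₃ _ _ {f₁} {f₁} (s≤s ())
  lookup-increasing₃ _ _ {f₂} {f₁} (s≤s ())
  lookup-increasing₃ _ _ {f₂} {f₂} (s≤s (s≤s ()))

strictlyIncreasing⁻ : ∀ {n k} {c : Vec (Fin n) k} → T (strictlyIncreasing c) →
  ∀ {p q} → p Fin.< q → lookup c p Fin.< lookup c q
strictlyIncreasing⁻ t {p} {q} p<q with to T-∨ (to T-allFin (to T-allFin t p) q)
... | inj₁ p≮q  = ⊥-elim (to T-not p≮q (<⇒<ᵇ p<q))
... | inj₂ cp<cq = <ᵇ⇒< _ _ cp<cq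

strictlyIncreasing⁺ : ∀ {n k} {c : Vec (Fin n) k} →
  (∀ {p q} → p Fin.< q → lookup c p Fin.< lookup c q) → T (strictlyIncreasing c)
strictlyIncreasing⁺ {c = c} increasing = from T-allFin λ p → from T-allFin λ q → from T-∨ (pair p q)
  where
  pair : ∀ p q → T (not (p <ᵇ q)) ⊎ T (lookup c p <ᵇ lookup c q)
  pair p q with p Fin.<? q
  ... | yes p<q = inj₂ (<⇒<ᵇ (increasing p<q))
  ... | no  p≮q = inj₁ (from T-not (p≮q ∘ <ᵇ⇒< _ _))

data Forbidden (x y z : ℕ) : Set where
  shape132 : x < z → z < y → Forbidden x y z
  shape231 : z < x → x < y → Forbidden x y z
  shape312 : y < z → z < x → Forbidden x y z

¬forbidden-123 : ∀ {x y z} → x < y → y < z → ¬ Forbidden x y z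
¬forbidden-123 x<y y<z (shape132 _   z<y) = <-asym y<z z<y
¬forbidden-123 x<y y<z (shape231 z<x _)   = <-asym z<x (<-trans x<y y<z)
¬forbidden-123 x<y y<z (shape312 _   z<x) = <-asym z<x (<-trans x<y y<z)

¬forbidden-213 : ∀ {x y z} → y < x → x < z → ¬ Forbidden x y z
¬forbidden-213 y<x x<z (shape132 _   z<y) = <-asym z<y (<-trans y<x x<z)
¬forbidden-213 y<x x<z (shape231 _   x<y) = <-asym x<y y<x
¬forbidden-213 y<x x<z (shape312 _   z<x) = <-asym z<x x<z

¬forbidden-321 : ∀ {x y z} → z < y → y < x → ¬ Forbidden x y z
¬forbidden-321 z<y y<x (shape132 x<z _)   = <-asym x<z (<-trans z<y y<x)
¬forbidden-321 z<y y<x (shape231 _   x<y) = <-asym x<y y<x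
¬forbidden-321 z<y y<x (shape312 y<z _)   = <-asym y<z z<y

PatternFree : ℕ → (ℕ → ℕ) → Set
PatternFree n f = ∀ {i j l} → i < j → j < l → l < n → ¬ Forbidden (f i) (f j) (f l)

PatternFree-cong : ∀ {n f g} → (∀ {i} → i < n → f i ≡ g i) → PatternFree n f → PatternFree n g
PatternFree-cong f≗g free i<j j<l l<n
  rewrite sym (f≗g (<-trans i<j (<-trans j<l l<n))) | sym (f≗g (<-trans j<l l<n)) | sym (f≗g l<n)
  = free i<j j<l l<n

orderAgrees : Word 3 → Vec ℕ 3 → Fin 3 → Fin 3 → Bool
orderAgrees π v c d = ⌊ (lookup v c ℕ.<ᵇ lookup v d) Bool.≟ (lookup π c <ᵇ lookup π d) ⌋

-- Opaque, so that Agda can infer π and v from T (matches π v) instead of unfolding it.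
opaque
  matches : Word 3 → Vec ℕ 3 → Bool
  matches π v = all (λ c → all (orderAgrees π v c) (allFin 3)) (allFin 3)

opaque
  unfolding matches

  T-matches : ∀ {π v} → T (matches π v) ⇔ (∀ c d → (lookup v c ℕ.<ᵇ lookup v d) ≡ (lookup π c <ᵇ lookup π d))
  T-matches {π} {v} = mk⇔
    (λ t c d → toWitness (to (T-allFin {p = orderAgrees π v c}) (to (T-allFin {p = row}) t c) d))
    (λ h → from (T-allFin {p = row}) λ c → from (T-allFin {p = orderAgrees π v c}) λ d → fromWitness (h c d))
    where
    row : Fin 3 → Bool
    row c = all (orderAgrees π v c) (allFin 3)

matches⇒< : ∀ {π v} → T (matches π v) → ∀ c d → T (lookup π c <ᵇ lookup π d) → lookup v c < lookup v d
matches⇒< t c d πc<πd = <ᵇ⇒< _ _ (subst T (sym (to T-matches t c d)) πc<πd)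

matches-resp : ∀ {π x y z x′ y′ z′} → x ≡ x′ → y ≡ y′ → z ≡ z′ →
  T (matches π (x ∷ y ∷ z ∷ [])) → T (matches π (x′ ∷ y′ ∷ z′ ∷ []))
matches-resp refl refl refl t = t

<ᵇ-embedding : ∀ {k} {u : Fin k → ℕ} → (∀ {c d} → c Fin.< d → u c < u d) →
  ∀ c d → (u c ℕ.<ᵇ u d) ≡ (c <ᵇ d)
<ᵇ-embedding {u = u} increasing c d =
  T-injective (mk⇔ (<⇒<ᵇ ∘ reflect ∘ <ᵇ⇒< _ _) (<⇒<ᵇ ∘ increasing ∘ <ᵇ⇒< _ _))
  where
  reflect : u c < u d → c Fin.< d
  reflect uc<ud with Fin.<-cmp c d
  ... | tri< c<d _ _  = c<d
  ... | tri≈ _ refl _ = ⊥-elim (<-irrefl refl uc<ud)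
  ... | tri> _ _ d<c  = ⊥-elim (<-asym uc<ud (increasing d<c))

matches-embedding : ∀ π (u : Vec ℕ 3) → (∀ {c d} → c Fin.< d → lookup u c < lookup u d) →
  T (matches π (tabulate (lookup u ∘ lookup π)))
matches-embedding π u increasing = from T-matches λ c d →
  trans (cong₂ ℕ._<ᵇ_ (lookup∘tabulate (lookup u ∘ lookup π) c) (lookup∘tabulate (lookup u ∘ lookup π) d))
        (<ᵇ-embedding increasing (lookup π c) (lookup π d))

patterns : List (Word 3)
patterns = p132 ∷ p231 ∷ p312 ∷ []

matches⇒forbidden : ∀ {π x y z} → π ∈ patterns → T (matches π (x ∷ y ∷ z ∷ [])) → Forbidden x y z
matches⇒forbidden (here refl)                 t = shape132 (matches⇒< t f₀ f₂ _) (matches⇒< t f₂ f₁ _)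
matches⇒forbidden (there (here refl))         t = shape231 (matches⇒< t f₂ f₀ _) (matches⇒< t f₀ f₁ _)
matches⇒forbidden (there (there (here refl))) t = shape312 (matches⇒< t f₁ f₂ _) (matches⇒< t f₂ f₀ _)

forbidden⇒matches : ∀ {x y z} → Forbidden x y z → ∃[ π ] π ∈ patterns × T (matches π (x ∷ y ∷ z ∷ []))
forbidden⇒matches {x} {y} {z} (shape132 x<z z<y) =
  p132 , here refl , matches-embedding p132 (x ∷ z ∷ y ∷ []) (lookup-increasing₃ _<_ <-trans x<z z<y)
forbidden⇒matches {x} {y} {z} (shape231 z<x x<y) =
  p231 , there (here refl) , matches-embedding p231 (z ∷ x ∷ y ∷ []) (lookup-increasing₃ _<_ <-trans z<x x<y)
forbidden⇒matches {x} {y} {z} (shape312 y<z z<x) =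
  p312 , there (there (here refl)) , matches-embedding p312 (y ∷ z ∷ x ∷ []) (lookup-increasing₃ _<_ <-trans y<z z<x)

fromℕ<-< : ∀ {n i j} (i<n : i < n) (j<n : j < n) → i < j → fromℕ< i<n Fin.< fromℕ< j<n
fromℕ<-< _ _ i<j = subst₂ _<_ (sym (Fin.toℕ-fromℕ< _)) (sym (Fin.toℕ-fromℕ< _)) i<j

Occurrence : ∀ {n} → Word n → Word 3 → Set
Occurrence {n} τ π = ∃[ i ] ∃[ j ] ∃[ l ] i < j × j < l × l < n × T (matches π (τ ! i ∷ τ ! j ∷ τ ! l ∷ []))

opaque
  unfolding matches

  contains⇒occurrence : ∀ {n} {τ : Word n} {π} → T (contains τ π) → Occurrence τ π
  contains⇒occurrence {n} {τ} {π} t with T-any⁻ {xs = allVecs n 3} t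
  ... | i ∷ j ∷ l ∷ [] , _ , t′ with to T-∧ t′
  ... | increasing , match =
    toℕ i , toℕ j , toℕ l , strictlyIncreasing⁻ {c = i ∷ j ∷ l ∷ []} increasing {f₀} {f₁} (s≤s z≤n) ,
    strictlyIncreasing⁻ {c = i ∷ j ∷ l ∷ []} increasing {f₁} {f₂} (s≤s (s≤s z≤n)) , Fin.toℕ<n l ,
    matches-resp {π = π} (sym (!-lookup τ i)) (sym (!-lookup τ j)) (sym (!-lookup τ l)) match

  occurrence⇒contains : ∀ {n} {τ : Word n} {π} → Occurrence τ π → T (contains τ π)
  occurrence⇒contains {n} {τ} {π} (i , j , l , i<j , j<l , l<n , match) =
    T-any⁺ {xs = allVecs n 3} (∈-allVecs c)
      (from T-∧ (strictlyIncreasing⁺ {c = c} (lookup-increasing₃ Fin._<_ Fin.<-trans (fromℕ<-< i<n j<n i<j) (fromℕ<-< j<n l<n j<l)) ,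
                 matches-resp {π = π} (!-fromℕ< τ i<n) (!-fromℕ< τ j<n) (!-fromℕ< τ l<n) match))
    where
    j<n : j < n
    j<n = <-trans j<l l<n
    i<n : i < n
    i<n = <-trans i<j j<n
    c : Vec (Fin n) 3
    c = fromℕ< i<n ∷ fromℕ< j<n ∷ fromℕ< l<n ∷ []

Avoiding : ∀ {n} → Word n → Set
Avoiding τ = All (λ π → T (avoids τ π)) patterns

avoiding⇒patternFree : ∀ {n} (τ : Word n) → Avoiding τ → PatternFree n (τ !_)
avoiding⇒patternFree τ avoiding i<j j<l l<n forbidden =
  let _ , π∈ , match = forbidden⇒matches forbidden
  in to T-not (All.lookup avoiding π∈) (occurrence⇒contains {τ = τ} (_ , _ , _ , i<j , j<l , l<n , match))

patternFree⇒avoiding : ∀ {n} (τ : Word n) → PatternFree n (τ !_) → Avoiding τ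
patternFree⇒avoiding τ free = All.tabulate λ {π} π∈ → from T-not λ t →
  let _ , _ , _ , i<j , j<l , l<n , match = contains⇒occurrence {τ = τ} {π} t
  in free i<j j<l l<n (matches⇒forbidden π∈ match)

avoidsAll₃⇔ : ∀ {n} {σ σ′ : Word n} →
  T (avoidsAll₃ patterns (σ , σ′)) ⇔ (Avoiding σ × Avoiding σ′ × Avoiding (σ′ ∘ₚ inv σ))
avoidsAll₃⇔ = mk⇔
  (λ t → let av , rest = All.unzipWith (to T-∧) (to T-all t) in av , All.unzipWith (to T-∧) rest)
  (λ (av , av′ , av″) → from T-all (All.zipWith (from T-∧) (av , All.zipWith (from T-∧) (av′ , av″))))

involutive⇒injective : ∀ {A : Set} {f : A → A} → (∀ x → f (f x) ≡ x) → Injective _≡_ _≡_ f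
involutive⇒injective {f = f} involutive {x} {y} fx≡fy =
  trans (sym (involutive x)) (trans (cong f fx≡fy) (involutive y))

isPerm⇒injective : ∀ {n} {τ : Word n} → T (isPerm τ) → Injective _≡_ _≡_ (lookup τ)
isPerm⇒injective t {i} {j} τi≡τj with to (T-∨ {⌊ i Fin.≟ j ⌋}) (to T-allFin (to T-allFin t i) j)
... | inj₁ i≡j   = toWitness i≡j
... | inj₂ τi≢τj = ⊥-elim (to T-not τi≢τj (fromWitness τi≡τj))

injective⇒isPerm : ∀ {n} {τ : Word n} → Injective _≡_ _≡_ (lookup τ) → T (isPerm τ)
injective⇒isPerm {τ = τ} injective = from T-allFin λ i → from T-allFin λ j → from T-∨ (dichotomy i j)
  where
  dichotomy : ∀ i j → T ⌊ i Fin.≟ j ⌋ ⊎ T (not ⌊ lookup τ i Fin.≟ lookup τ j ⌋)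
  dichotomy i j with i Fin.≟ j
  ... | yes _   = inj₁ _
  ... | no  i≢j = inj₂ (from T-not (i≢j ∘ injective ∘ toWitness))

∈-Perms⁺ : ∀ {n} {τ : Word n} → Injective _≡_ _≡_ (lookup τ) → τ ∈ Perms n
∈-Perms⁺ {τ = τ} injective = ∈-filter⁺ (Bool.T? ∘ isPerm) (∈-allVecs τ) (injective⇒isPerm {τ = τ} injective)

∈-Perms⁻ : ∀ {n} {τ : Word n} → τ ∈ Perms n → Injective _≡_ _≡_ (lookup τ)
∈-Perms⁻ {n} {τ} τ∈ = isPerm⇒injective {τ = τ} (proj₂ (∈-filter⁻ (Bool.T? ∘ isPerm) {xs = allVecs n n} τ∈))

injective⇒surjective : ∀ {n} {f : Fin n → Fin n} → Injective _≡_ _≡_ f → ∀ y → ∃[ x ] f x ≡ y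
injective⇒surjective {suc n} {f} injective y with Fin.any? (λ x → f x Fin.≟ y)
... | yes hit  = hit
... | no  miss = ⊥-elim (Fin.<⇒notInjective (n<1+n n)
                   (λ {x} {x′} e → injective (Fin.punchOut-injective (missed x) (missed x′) e)))
  where
  missed : ∀ x → y ≢ f x
  missed x y≡fx = miss (x , sym y≡fx)

-- The permutations avoiding 132, 231 and 312

rev : ℕ → ℕ → ℕ
rev m i = if i ℕ.≤ᵇ m then m ∸ i else i

rev-≤ : ∀ {m i} → i ≤ m → rev m i ≡ m ∸ i
rev-≤ {m} {i} i≤m with i ℕ.≤ᵇ m in e
... | true  = refl
... | false = ⊥-elim (subst T e (≤⇒≤ᵇ i≤m))

rev-> : ∀ {m i} → m < i → rev m i ≡ i
rev-> {m} {i} m<i with i ℕ.≤ᵇ m in e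
... | false = refl
... | true  = ⊥-elim (<⇒≱ m<i (≤ᵇ⇒≤ i m (subst T (sym e) _)))

data RevView (m i : ℕ) : Set where
  below : i ≤ m → rev m i ≡ m ∸ i → RevView m i
  above : m < i → rev m i ≡ i → RevView m i

revView : ∀ m i → RevView m i
revView m i with i ≤? m
... | yes i≤m = below i≤m (rev-≤ i≤m)
... | no  i≰m = above (≰⇒> i≰m) (rev-> (≰⇒> i≰m))

rev-identity : ∀ i → rev 0 i ≡ i
rev-identity i with revView 0 i
... | below z≤n e = e
... | above _   e = e

rev-involutive : ∀ m i → rev m (rev m i) ≡ i
rev-involutive m i with revView m i
... | below i≤m e rewrite e = trans (rev-≤ (m∸n≤m m i)) (m∸[m∸n]≡n i≤m)
... | above _   e rewrite e = e

rev-injective : ∀ m → Injective _≡_ _≡_ (rev m)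
rev-injective m = involutive⇒injective (rev-involutive m)

rev-< : ∀ {m n i} → m < n → i < n → rev m i < n
rev-< {m} {n} {i} m<n i<n with revView m i
... | below _ e = subst (_< n) (sym e) (≤-<-trans (m∸n≤m m i) m<n)
... | above _ e = subst (_< n) (sym e) i<n

rev-patternFree : ∀ {n} m → PatternFree n (rev m)
rev-patternFree m {i} {j} {l} i<j j<l _ with revView m i | revView m j | revView m l
... | below _ ei | below j≤m ej | below l≤m el rewrite ei | ej | el =
  ¬forbidden-321 (∸-monoʳ-< j<l l≤m) (∸-monoʳ-< i<j j≤m)
... | below _ ei | below j≤m ej | above m<l el rewrite ei | ej | el =
  ¬forbidden-213 (∸-monoʳ-< i<j j≤m) (≤-<-trans (m∸n≤m m i) m<l)
... | below _ ei | above m<j ej | above _ el rewrite ei | ej | el =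
  ¬forbidden-123 (≤-<-trans (m∸n≤m m i) m<j) j<l
... | above _ ei | above _ ej | above _ el rewrite ei | ej | el =
  ¬forbidden-123 i<j j<l
... | above m<i _ | below j≤m _ | _ = ⊥-elim (<⇒≱ (<-trans m<i i<j) j≤m)
... | _ | above m<j _ | below l≤m _ = ⊥-elim (<⇒≱ (<-trans m<j j<l) l≤m)

module _ {n} {f : ℕ → ℕ}
  (f-< : ∀ {i} → i < n → f i < n)
  (f-injective : ∀ {i j} → i < n → j < n → f i ≡ f j → i ≡ j)
  (f-surjective : ∀ {w} → w < n → ∃[ r ] r < n × f r ≡ w)
  (f-free : PatternFree n f) where

  private
    AgreesBelow : ℕ → Set
    AgreesBelow l = ∀ {i} → i < l → f i ≡ rev (f 0) i

    takenBelow : ∀ {l} → AgreesBelow l → l < n → ∀ {w} → rev (f 0) w < l → f l ≢ w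
    takenBelow {l} agree l<n {w} w′<l fl≡w = <-irrefl (sym l≡w′) w′<l
      where
      l≡w′ : l ≡ rev (f 0) w
      l≡w′ = f-injective l<n (<-trans w′<l l<n)
               (trans fl≡w (sym (trans (agree w′<l) (rev-involutive (f 0) w))))

    preimageAbove : ∀ {l} → AgreesBelow l → l < n → f l ≢ rev (f 0) l →
      ∃[ r ] l < r × r < n × f r ≡ rev (f 0) l
    preimageAbove {l} agree l<n fl≢v with f-surjective (rev-< (f-< (≤-<-trans z≤n l<n)) l<n)
    ... | r , r<n , fr≡v with <-cmp r l
    ... | tri< r<l _ _  = ⊥-elim (<-irrefl (rev-injective (f 0) (trans (sym (agree r<l)) fr≡v)) r<l)
    ... | tri≈ _ refl _ = ⊥-elim (fl≢v fr≡v)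
    ... | tri> _ _ l<r  = r , l<r , r<n , fr≡v

    notForbidden : ∀ {l} → 0 < l → AgreesBelow l → l < n → f l ≢ rev (f 0) l →
      ¬ Forbidden (f 0) (f l) (rev (f 0) l)
    notForbidden {l} 0<l agree l<n fl≢v forbidden =
      let r , l<r , r<n , fr≡v = preimageAbove agree l<n fl≢v
      in f-free 0<l l<r r<n (subst (Forbidden (f 0) (f l)) (sym fr≡v) forbidden)

    -- With m = f 0 and v = rev m l: if f l ≠ v, then either f l repeats a value taken
    -- below l, or v is taken at some r > l and the values (m, f l, v) form a forbidden triple.
    extend : ∀ {l} → 0 < l → AgreesBelow l → l < n → f l ≡ rev (f 0) l
    extend {l} 0<l agree l<n with revView (f 0) l | <-cmp (f l) (rev (f 0) l)
    ... | _ | tri≈ _ fl≡v _ = fl≡v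
    ... | below l≤m v≡ | tri< fl<v fl≢v _ =
      ⊥-elim (notForbidden 0<l agree l<n fl≢v (shape312 fl<v (subst (_< f 0) (sym v≡) (∸-monoʳ-< 0<l l≤m))))
    ... | above m<l v≡ | tri< fl<v _ _ =
      ⊥-elim (takenBelow agree l<n (rev-< m<l (subst (f l <_) v≡ fl<v)) refl)
    ... | above m<l v≡ | tri> _ fl≢v v<fl =
      ⊥-elim (notForbidden 0<l agree l<n fl≢v (shape132 (subst (f 0 <_) (sym v≡) m<l) v<fl))
    ... | below l≤m v≡ | tri> _ fl≢v v<fl with f l ≤? f 0
    ...   | no  fl≰m = ⊥-elim (notForbidden 0<l agree l<n fl≢v
                         (shape231 (subst (_< f 0) (sym v≡) (∸-monoʳ-< 0<l l≤m)) (≰⇒> fl≰m)))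
    ...   | yes fl≤m = ⊥-elim (takenBelow agree l<n revfl<l refl)
      where
      revfl<l : rev (f 0) (f l) < l
      revfl<l = subst₂ _<_ (sym (rev-≤ fl≤m)) (m∸[m∸n]≡n l≤m)
                  (∸-monoʳ-< (subst (_< f l) v≡ v<fl) fl≤m)

  patternFree-bijection⇒rev : ∀ {l} → l < n → f l ≡ rev (f 0) l
  patternFree-bijection⇒rev {l} = <-rec (λ l → l < n → f l ≡ rev (f 0) l) agree l
    where
    agree : ∀ l → (∀ {i} → i < l → i < n → f i ≡ rev (f 0) i) → l < n → f l ≡ rev (f 0) l
    agree zero    _   _   = refl
    agree (suc l) rec l<n = extend z<s (λ i<l → rec i<l (<-trans i<l l<n)) l<n

revWord : ∀ {n} → Fin n → Word n
revWord m = tabulate λ i → fromℕ< (rev-< (Fin.toℕ<n m) (Fin.toℕ<n i))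

toℕ-revWord : ∀ {n} (m i : Fin n) → toℕ (lookup (revWord m) i) ≡ rev (toℕ m) (toℕ i)
toℕ-revWord m i = trans (cong toℕ (lookup∘tabulate _ i)) (Fin.toℕ-fromℕ< _)

revWord-! : ∀ {n i} (m : Fin n) → i < n → revWord m ! i ≡ rev (toℕ m) i
revWord-! m i<n = trans (!-fromℕ< (revWord m) i<n)
  (trans (toℕ-revWord m _) (cong (rev (toℕ m)) (Fin.toℕ-fromℕ< i<n)))

revWord-involutive : ∀ {n} (m i : Fin n) → lookup (revWord m) (lookup (revWord m) i) ≡ i
revWord-involutive m i = Fin.toℕ-injective (begin
  toℕ (lookup (revWord m) (lookup (revWord m) i)) ≡⟨ toℕ-revWord m _ ⟩
  rev (toℕ m) (toℕ (lookup (revWord m) i))       ≡⟨ cong (rev (toℕ m)) (toℕ-revWord m i) ⟩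
  rev (toℕ m) (rev (toℕ m) (toℕ i))              ≡⟨ rev-involutive (toℕ m) (toℕ i) ⟩
  toℕ i                                          ∎)
  where open ≡-Reasoning

lookup-revWord-injective : ∀ {n} (m : Fin n) → Injective _≡_ _≡_ (lookup (revWord m))
lookup-revWord-injective m = involutive⇒injective (revWord-involutive m)

revWord-injective : ∀ {k} → Injective _≡_ _≡_ (revWord {suc k})
revWord-injective {x = c} {d} e = Fin.toℕ-injective (begin
  toℕ c                ≡⟨ revWord-! c z<s ⟨
  revWord c ! 0        ≡⟨ cong (_! 0) e ⟩
  revWord d ! 0        ≡⟨ revWord-! d z<s ⟩
  toℕ d                ∎)
  where open ≡-Reasoning

revWord-patternFree : ∀ {n} (m : Fin n) → PatternFree n (revWord m !_)
revWord-patternFree m = PatternFree-cong (sym ∘ revWord-! m) (rev-patternFree (toℕ m))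

permutation⇒revWord : ∀ {k} {τ : Word (suc k)} → Injective _≡_ _≡_ (lookup τ) →
  PatternFree (suc k) (τ !_) → τ ≡ revWord (lookup τ Fin.zero)
permutation⇒revWord {τ = τ@(_ ∷ _)} injective free = !-ext τ _ λ l<n →
  trans (patternFree-bijection⇒rev (!-< τ) (!-injective {v = τ} injective)
           (!-surjective {v = τ} (injective⇒surjective injective)) free l<n)
        (sym (revWord-! _ l<n))

findPre-lookup : ∀ {n m} (v : Vec (Fin n) (suc m)) → Injective _≡_ _≡_ (lookup v) →
  ∀ i → findPre v (lookup v i) ≡ i
findPre-lookup {m = zero}  (_ ∷ [])     _ Fin.zero = refl
findPre-lookup {m = suc m} (x ∷ _ ∷ _) _ Fin.zero with x Fin.≟ x
... | yes _   = refl
... | no  x≢x = ⊥-elim (x≢x refl)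
findPre-lookup {m = suc m} (x ∷ y ∷ ys) injective (Fin.suc i) with x Fin.≟ lookup (y ∷ ys) i
... | yes x≡vi with () ← injective {Fin.zero} {Fin.suc i} x≡vi
... | no  _    = cong Fin.suc (findPre-lookup (y ∷ ys) (Fin.suc-injective ∘ injective) i)

inv-involutive : ∀ {n} (τ : Word n) → (∀ i → lookup τ (lookup τ i) ≡ i) → inv τ ≡ τ
inv-involutive {zero}  []  _         = refl
inv-involutive {suc n} τ involutive = trans
  (tabulate-cong λ j → trans (cong (findPre τ) (sym (involutive j)))
                             (findPre-lookup τ (involutive⇒injective involutive) (lookup τ j)))
  (tabulate∘lookup τ)

revWord-∘-inv-! : ∀ {n i} (c d : Fin n) → i < n →
  (revWord d ∘ₚ inv (revWord c)) ! i ≡ rev (toℕ d) (rev (toℕ c) i)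
revWord-∘-inv-! {i = i} c d i<n = begin
  (revWord d ∘ₚ inv (revWord c)) ! i   ≡⟨ cong (λ w → (revWord d ∘ₚ w) ! i) (inv-involutive _ (revWord-involutive c)) ⟩
  (revWord d ∘ₚ revWord c) ! i         ≡⟨ !-fromℕ< (revWord d ∘ₚ revWord c) i<n ⟩
  toℕ (lookup (revWord d ∘ₚ revWord c) i′)         ≡⟨ cong toℕ (lookup∘tabulate _ i′) ⟩
  toℕ (lookup (revWord d) (lookup (revWord c) i′)) ≡⟨ toℕ-revWord d _ ⟩
  rev (toℕ d) (toℕ (lookup (revWord c) i′))       ≡⟨ cong (rev (toℕ d)) (toℕ-revWord c i′) ⟩
  rev (toℕ d) (rev (toℕ c) (toℕ i′))              ≡⟨ cong (rev (toℕ d) ∘ rev (toℕ c)) (Fin.toℕ-fromℕ< i<n) ⟩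
  rev (toℕ d) (rev (toℕ c) i)                     ∎
  where
  open ≡-Reasoning
  i′ : Fin _
  i′ = fromℕ< i<n

-- Compatible pairs

rev∘rev-forbiddenˡ : ∀ {c d} → 0 < c → c < d →
  Forbidden (rev d (rev c 0)) (rev d (rev c 1)) (rev d (rev c (suc c)))
rev∘rev-forbiddenˡ {c} {d} 0<c c<d
  rewrite rev-≤ {c} {1} 0<c | rev-> {c} (n<1+n c)
        | rev-≤ {d} {c} (<⇒≤ c<d) | rev-≤ {d} {c ∸ 1} (≤-trans (m∸n≤m c 1) (<⇒≤ c<d)) | rev-≤ {d} {suc c} c<d
  = shape231 (∸-monoʳ-< (n<1+n c) c<d) (∸-monoʳ-< (∸-monoʳ-< z<s 0<c) (<⇒≤ c<d))

rev∘rev-forbiddenʳ : ∀ {c d} → 0 < d → d < c →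
  Forbidden (rev d (rev c 0)) (rev d (rev c (c ∸ d))) (rev d (rev c (suc (c ∸ d))))
rev∘rev-forbiddenʳ {c} {d} 0<d d<c = forbidden
  where
  c∸d<c : c ∸ d < c
  c∸d<c = ∸-monoʳ-< 0<d (<⇒≤ d<c)
  c∸sc∸d<d : c ∸ suc (c ∸ d) < d
  c∸sc∸d<d = subst (c ∸ suc (c ∸ d) <_) (m∸[m∸n]≡n (<⇒≤ d<c)) (∸-monoʳ-< (n<1+n _) c∸d<c)
  forbidden : Forbidden (rev d (rev c 0)) (rev d (rev c (c ∸ d))) (rev d (rev c (suc (c ∸ d))))
  forbidden
    rewrite rev-> d<c
          | rev-≤ (m∸n≤m c d) | m∸[m∸n]≡n (<⇒≤ d<c) | rev-≤ (≤-refl {d}) | n∸n≡0 d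
          | rev-≤ c∸d<c | rev-≤ (<⇒≤ c∸sc∸d<d)
    = shape312 (m<n⇒0<n∸m c∸sc∸d<d) (≤-<-trans (m∸n≤m d (c ∸ suc (c ∸ d))) d<c)

data Compatible {k} : Fin (suc k) → Fin (suc k) → Set where
  zeroˡ    : ∀ d → Compatible Fin.zero d
  zeroʳ    : ∀ c → Compatible (Fin.suc c) Fin.zero
  diagonal : ∀ c → Compatible (Fin.suc c) (Fin.suc c)

compatible⇒patternFree : ∀ {k} {c d : Fin (suc k)} → Compatible c d →
  PatternFree (suc k) (rev (toℕ d) ∘ rev (toℕ c))
compatible⇒patternFree (zeroˡ d) =
  PatternFree-cong (λ {i} _ → cong (rev (toℕ d)) (sym (rev-identity i))) (rev-patternFree (toℕ d))
compatible⇒patternFree (zeroʳ c) =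
  PatternFree-cong (λ {i} _ → sym (rev-identity (rev (toℕ (Fin.suc c)) i))) (rev-patternFree (toℕ (Fin.suc c)))
compatible⇒patternFree (diagonal c) =
  PatternFree-cong (λ {i} _ → trans (rev-identity i) (sym (rev-involutive (toℕ (Fin.suc c)) i))) (rev-patternFree 0)

patternFree⇒compatible : ∀ {k} (c d : Fin (suc k)) →
  PatternFree (suc k) (rev (toℕ d) ∘ rev (toℕ c)) → Compatible c d
patternFree⇒compatible Fin.zero    d           _ = zeroˡ d
patternFree⇒compatible (Fin.suc c) Fin.zero    _ = zeroʳ c
patternFree⇒compatible (Fin.suc c) (Fin.suc d) free with <-cmp (toℕ c) (toℕ d)
... | tri≈ _ c≡d _ rewrite Fin.toℕ-injective c≡d = diagonal d
... | tri< c<d _ _ =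
  ⊥-elim (free z<s (s<s z<s) (≤-<-trans (s<s c<d) (Fin.toℕ<n (Fin.suc d))) (rev∘rev-forbiddenˡ z<s (s<s c<d)))
... | tri> _ _ d<c =
  ⊥-elim (free (m<n⇒0<n∸m (s<s d<c)) (n<1+n _) (≤-<-trans (∸-monoʳ-< z<s (<⇒≤ (s<s d<c))) (Fin.toℕ<n (Fin.suc c)))
               (rev∘rev-forbiddenʳ z<s (s<s d<c)))

module _ {k : ℕ} where

  fromZero : Fin (suc k) → Fin (suc k) × Fin (suc k)
  fromZero d = Fin.zero , d

  toZero : Fin k → Fin (suc k) × Fin (suc k)
  toZero c = Fin.suc c , Fin.zero

  onDiagonal : Fin k → Fin (suc k) × Fin (suc k)
  onDiagonal c = Fin.suc c , Fin.suc c

  compatiblePairs : List (Fin (suc k) × Fin (suc k))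
  compatiblePairs = map fromZero (allFin (suc k)) ++ map toZero (allFin k) ++ map onDiagonal (allFin k)

  ∈-compatiblePairs⁺ : ∀ {c d} → Compatible c d → (c , d) ∈ compatiblePairs
  ∈-compatiblePairs⁺ (zeroˡ d)    = ∈-++⁺ˡ (∈-map⁺ fromZero (∈-allFin d))
  ∈-compatiblePairs⁺ (zeroʳ c)    = ∈-++⁺ʳ (map fromZero (allFin (suc k))) (∈-++⁺ˡ (∈-map⁺ toZero (∈-allFin c)))
  ∈-compatiblePairs⁺ (diagonal c) = ∈-++⁺ʳ (map fromZero (allFin (suc k))) (∈-++⁺ʳ (map toZero (allFin k)) (∈-map⁺ onDiagonal (∈-allFin c)))

  ∈-compatiblePairs⁻ : ∀ {c d} → (c , d) ∈ compatiblePairs → Compatible c d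
  ∈-compatiblePairs⁻ cd∈ with ∈-++⁻ (map fromZero (allFin (suc k))) cd∈
  ... | inj₁ cd∈₁ with ∈-map⁻ fromZero cd∈₁
  ...   | d , _ , refl = zeroˡ d
  ∈-compatiblePairs⁻ cd∈ | inj₂ cd∈₂₃ with ∈-++⁻ (map toZero (allFin k)) cd∈₂₃
  ... | inj₁ cd∈₂ with ∈-map⁻ toZero cd∈₂
  ...   | c , _ , refl = zeroʳ c
  ∈-compatiblePairs⁻ cd∈ | inj₂ cd∈₂₃ | inj₂ cd∈₃ with ∈-map⁻ onDiagonal cd∈₃
  ...   | c , _ , refl = diagonal c

  compatiblePairs-unique : Unique compatiblePairs
  compatiblePairs-unique =
    Unique.++⁺ (Unique.map⁺ (cong proj₂) (Unique.allFin⁺ (suc k)))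
               (Unique.++⁺ (Unique.map⁺ (Fin.suc-injective ∘ cong proj₁) (Unique.allFin⁺ k))
                           (Unique.map⁺ (Fin.suc-injective ∘ cong proj₁) (Unique.allFin⁺ k))
                           disjoint₂₃)
               disjoint₁
    where
    disjoint₂₃ : ∀ {v} → ¬ (v ∈ map toZero (allFin k) × v ∈ map onDiagonal (allFin k))
    disjoint₂₃ (v∈₂ , v∈₃) with ∈-map⁻ toZero v∈₂ | ∈-map⁻ onDiagonal v∈₃
    ... | _ , _ , refl | _ , _ , ()
    disjoint₁ : ∀ {v} → ¬ (v ∈ map fromZero (allFin (suc k)) × v ∈ map toZero (allFin k) ++ map onDiagonal (allFin k))
    disjoint₁ (v∈₁ , v∈₂₃) with ∈-map⁻ fromZero v∈₁ | ∈-++⁻ (map toZero (allFin k)) v∈₂₃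
    ... | _ , _ , refl | inj₁ v∈₂ with ∈-map⁻ toZero v∈₂
    ...   | _ , _ , ()
    disjoint₁ (v∈₁ , v∈₂₃) | _ , _ , refl | inj₂ v∈₃ with ∈-map⁻ onDiagonal v∈₃
    ...   | _ , _ , ()

  length-compatiblePairs : length compatiblePairs ≡ suc k + (k + k)
  length-compatiblePairs =
    trans (length-++ (map fromZero (allFin (suc k))))
      (cong₂ _+_ (length-map-allFin fromZero)
                 (trans (length-++ (map toZero (allFin k))) (cong₂ _+_ (length-map-allFin toZero) (length-map-allFin onDiagonal))))
    where
    length-map-allFin : ∀ {n} {A : Set} (f : Fin n → A) → length (map f (allFin n)) ≡ n
    length-map-allFin {n} f = trans (length-map f (allFin n)) (length-tabulate (λ i → i))

revPair : ∀ {k} → Fin (suc k) × Fin (suc k) → Word (suc k) × Word (suc k)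
revPair (c , d) = revWord c , revWord d

revPairs : ∀ k → List (Word (suc k) × Word (suc k))
revPairs k = map revPair (compatiblePairs {k})

revPairs-unique : ∀ k → Unique (revPairs k)
revPairs-unique k = Unique.map⁺
  (λ e → cong₂ _,_ (revWord-injective (cong proj₁ e)) (revWord-injective (cong proj₂ e)))
  (compatiblePairs-unique {k})

PermPairs : ∀ n → List (Word n × Word n)
PermPairs n = concatMap (λ σ → map (σ ,_) (Perms n)) (Perms n)

PermPairs≡cartesianProduct : ∀ n → PermPairs n ≡ cartesianProduct (Perms n) (Perms n)
PermPairs≡cartesianProduct n = concatMap-map≡cartesianProductWith _,_ (Perms n) (Perms n)

PermPairs-unique : ∀ n → Unique (PermPairs n)
PermPairs-unique n = subst Unique (sym (PermPairs≡cartesianProduct n))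
  (Unique.cartesianProduct⁺ Perms-unique Perms-unique)
  where
  Perms-unique : Unique (Perms n)
  Perms-unique = Unique.filter⁺ _ (allVecs-unique n n)

∈-revPairs⁻ : ∀ {k s} → s ∈ revPairs k → s ∈ PermPairs (suc k) × T (avoidsAll₃ patterns s)
∈-revPairs⁻ {k} s∈ with ∈-map⁻ revPair s∈
... | (c , d) , cd∈ , refl =
  subst (revPair (c , d) ∈_) (sym (PermPairs≡cartesianProduct (suc k)))
        (∈-cartesianProduct⁺ (∈-Perms⁺ (lookup-revWord-injective c)) (∈-Perms⁺ (lookup-revWord-injective d))) ,
  from (avoidsAll₃⇔ {σ = revWord c} {revWord d})
    (patternFree⇒avoiding (revWord c) (revWord-patternFree c) ,
     patternFree⇒avoiding (revWord d) (revWord-patternFree d) ,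
     patternFree⇒avoiding (revWord d ∘ₚ inv (revWord c))
       (PatternFree-cong (sym ∘ revWord-∘-inv-! c d) (compatible⇒patternFree (∈-compatiblePairs⁻ cd∈))))

∈-revPairs⁺ : ∀ {k s} → s ∈ PermPairs (suc k) × T (avoidsAll₃ patterns s) → s ∈ revPairs k
∈-revPairs⁺ {k} {σ , σ′} (s∈ , t) =
  subst (_∈ revPairs k) (sym (cong₂ _,_ σ≡ σ′≡))
        (∈-map⁺ revPair (∈-compatiblePairs⁺ (patternFree⇒compatible c d composite-free)))
  where
  σ∈×σ′∈ : σ ∈ Perms (suc k) × σ′ ∈ Perms (suc k)
  σ∈×σ′∈ = ∈-cartesianProduct⁻ (Perms (suc k)) (Perms (suc k)) (subst ((σ , σ′) ∈_) (PermPairs≡cartesianProduct (suc k)) s∈)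
  c d : Fin (suc k)
  c = lookup σ Fin.zero
  d = lookup σ′ Fin.zero
  avoiding : Avoiding σ × Avoiding σ′ × Avoiding (σ′ ∘ₚ inv σ)
  avoiding = to (avoidsAll₃⇔ {σ = σ} {σ′}) t
  σ≡ : σ ≡ revWord c
  σ≡ = permutation⇒revWord (∈-Perms⁻ (proj₁ σ∈×σ′∈)) (avoiding⇒patternFree σ (proj₁ avoiding))
  σ′≡ : σ′ ≡ revWord d
  σ′≡ = permutation⇒revWord (∈-Perms⁻ (proj₂ σ∈×σ′∈)) (avoiding⇒patternFree σ′ (proj₁ (proj₂ avoiding)))
  composite-free : PatternFree (suc k) (rev (toℕ d) ∘ rev (toℕ c))
  composite-free = PatternFree-cong
    (λ {i} i<n → trans (cong₂ (λ u w → (w ∘ₚ inv u) ! i) σ≡ σ′≡) (revWord-∘-inv-! c d i<n))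
    (avoiding⇒patternFree (σ′ ∘ₚ inv σ) (proj₂ (proj₂ avoiding)))

a-suc : ∀ k → a (suc k) ≡ suc k + (k + k)
a-suc k = begin
  a (suc k)                     ≡⟨ length-filterᵇ-unique (PermPairs-unique (suc k)) (revPairs-unique k)
                                                          (mk⇔ ∈-revPairs⁻ ∈-revPairs⁺) ⟩
  length (revPairs k)           ≡⟨ length-map revPair (compatiblePairs {k}) ⟩
  length (compatiblePairs {k})  ≡⟨ length-compatiblePairs {k} ⟩
  suc k + (k + k)               ∎
  where open ≡-Reasoning

theorem4p3 : (a 1 ≡ 1) × (∀ (n : ℕ) → n ≥ 1 → a (suc n) ≡ a n + 3)
theorem4p3 = a-suc 0 , step
  where
  open ≡-Reasoning
  arithmetic : ∀ k → suc (suc k) + (suc k + suc k) ≡ suc k + (k + k) + 3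
  arithmetic = solve-∀
  step : ∀ n → n ≥ 1 → a (suc n) ≡ a n + 3
  step (suc k) _ = begin
    a (suc (suc k))               ≡⟨ a-suc (suc k) ⟩
    suc (suc k) + (suc k + suc k) ≡⟨ arithmetic k ⟩
    suc k + (k + k) + 3           ≡⟨ cong (_+ 3) (a-suc k) ⟨
    a (suc k) + 3                 ∎
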